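{- Let $\mathcal M$ be a regular $n$-maniplex with base flag $\Phi$ and automorphism group $\Gamma(\mathcal M)=\langle\rho_0,\dots,\rho_{n-1}\rangle$, where $\rho_i$ is the automorphism with $\Phi\rho_i=r_i\Phi$. Let $N^+_{n-1}$ be the normal closure of $\langle\rho_{n-1}\rangle$ in $\Gamma(\mathcal M)$. Then $\mathcal M$ is a canonical Cayley extension if and only if $N^+_{n-1}$ acts regularly on the facets of $\mathcal M$.
   Context: An $n$-premaniplex is a graph (semi-edges and parallel edges allowed) whose vertices, called flags, carry a proper edge colouring with colours $0,\dots,n-1$, each flag $\Psi$ having exactly one incident dart of each colour $i$, with other end $r_i\Psi$ (also written $\Psi^i$); one requires $r_ir_jr_ir_j=1$ for $|i-j|>1$. An $n$-maniplex is a connected $n$-premaniplex in which $r_i$ and $r_ir_j$ ($i\ne j$) have no fixed points. Facets are components after deleting colour-$(n-1)$ edges. Automorphisms are colour-preserving graph automorphisms acting on the right; $\Gamma(\mathcal M)$ is the automorphism group. $\mathcal M$ is regular if $\Gamma(\mathcal M)$ acts transitively on flags. An $n$-maniplex $\mathcal M$ is a canonical Cayley extension if there is a subgroup $G\le\Gamma(\mathcal M)$ acting regularly (transitively and freely) on the facets of $\mathcal M$ such that for every flag $\Psi$ of $\mathcal M$ there is $\gamma\in G$ with $\Psi^{n-1}=\Psi\gamma$. -}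

module Defs where

open import Data.Nat using (ℕ; suc; _<_; ∣_-_∣)
open import Data.Fin using (Fin; fromℕ; inject₁; toℕ)
open import Data.Product using (Σ; _×_; _,_; ∃)
open import Relation.Binary.PropositionalEquality using (_≡_; refl; trans; cong; sym)
open import Relation.Binary.Construct.Closure.ReflexiveTransitive using (Star)
open import Relation.Nullary using (¬_)

-- An n-premaniplex: a set of flags with, for each colour i, the involution
-- r i (the other end of the unique dart of colour i; semi-edges = fixed points),
-- such that r i r j r i r j = 1 whenever |i - j| > 1.
record Premaniplex (n : ℕ) : Set₁ where
  field
    Flag : Set
    r    : Fin n → Flag → Flag
    r-invol : ∀ i Ψ → r i (r i Ψ) ≡ Ψ
    r-comm  : ∀ (i j : Fin n) → 1 < ∣ toℕ i - toℕ j ∣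
            → ∀ Ψ → r i (r j (r i (r j Ψ))) ≡ Ψ

module _ {n : ℕ} (P : Premaniplex n) where
  open Premaniplex P

  Step : Flag → Flag → Set
  Step Ψ Ψ' = Σ (Fin n) λ i → r i Ψ ≡ Ψ'

  Connected : Set
  Connected = ∀ Ψ Ψ' → Star Step Ψ Ψ'

  IsManiplex : Set
  IsManiplex = Connected
             × (∀ i Ψ → ¬ (r i Ψ ≡ Ψ))
             × (∀ i j → ¬ (i ≡ j) → ∀ Ψ → ¬ (r i (r j Ψ) ≡ Ψ))

  -- Automorphisms: colour-preserving bijections of the flags.
  -- They act on the right: Ψ γ is written  act γ Ψ.
  record Aut : Set where
    field
      act    : Flag → Flag
      actInv : Flag → Flag
      inv-l  : ∀ Ψ → actInv (act Ψ) ≡ Ψ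
      inv-r  : ∀ Ψ → act (actInv Ψ) ≡ Ψ
      comm   : ∀ i Ψ → act (r i Ψ) ≡ r i (act Ψ)
  open Aut public

  _≈_ : Aut → Aut → Set
  γ ≈ δ = ∀ Ψ → act γ Ψ ≡ act δ Ψ

  idA : Aut
  idA = record { act = λ Ψ → Ψ ; actInv = λ Ψ → Ψ
               ; inv-l = λ _ → refl
               ; inv-r = λ _ → refl
               ; comm = λ _ _ → refl }

  _·_ : Aut → Aut → Aut
  γ · δ = record
    { act = λ Ψ → act δ (act γ Ψ)
    ; actInv = λ Ψ → actInv γ (actInv δ Ψ)
    ; inv-l = λ Ψ → trans (cong (actInv γ) (inv-l δ (act γ Ψ))) (inv-l γ Ψ)
    ; inv-r = λ Ψ → trans (cong (act δ) (inv-r γ (actInv δ Ψ))) (inv-r δ Ψ)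
    ; comm = λ i Ψ → trans (cong (act δ) (comm γ i Ψ)) (comm δ i (act γ Ψ)) }

  _⁻¹ : Aut → Aut
  γ ⁻¹ = record
    { act = actInv γ ; actInv = act γ ; inv-l = inv-r γ ; inv-r = inv-l γ
    ; comm = λ i Ψ → trans (sym (cong (λ x → actInv γ (r i x)) (inv-r γ Ψ)))
                     (trans (cong (actInv γ) (sym (comm γ i (actInv γ Ψ))))
                            (inv-l γ (r i (actInv γ Ψ)))) }

  IsRegular : Set
  IsRegular = ∀ Ψ Ψ' → Σ Aut λ γ → act γ Ψ ≡ Ψ'

  record IsSubgroup (G : Aut → Set) : Set where
    field
      resp : ∀ {γ δ} → γ ≈ δ → G γ → G δ
      has-id : G idA
      has-mul : ∀ {γ δ} → G γ → G δ → G (γ · δ)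
      has-inv : ∀ {γ} → G γ → G (γ ⁻¹)

module _ {m : ℕ} (P : Premaniplex (suc m)) where
  open Premaniplex P

  top : Fin (suc m)
  top = fromℕ m

  FacetStep : Flag → Flag → Set
  FacetStep Ψ Ψ' = Σ (Fin m) λ i → r (inject₁ i) Ψ ≡ Ψ'

  -- two flags lie in the same facet (same component after deleting
  -- colour-(n-1) edges)
  SameFacet : Flag → Flag → Set
  SameFacet = Star FacetStep

  ActsRegularlyOnFacets : (Aut P → Set) → Set
  ActsRegularlyOnFacets G =
      (∀ Ψ Ψ' → Σ (Aut P) λ γ → G γ × SameFacet (act γ Ψ) Ψ')
    × (∀ γ → G γ → ∀ Ψ → SameFacet (act γ Ψ) Ψ → _≈_ P γ (idA P))

  IsCanonicalCayleyExtension : Set₁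
  IsCanonicalCayleyExtension =
    Σ (Aut P → Set) λ G →
        IsSubgroup P G
      × ActsRegularlyOnFacets G
      × (∀ Ψ → Σ (Aut P) λ γ → G γ × (r top Ψ ≡ act γ Ψ))

  data NormalClosure (ρ : Aut P) : Aut P → Set where
    conj : ∀ δ {γ} → _≈_ P γ (_·_ P (_·_ P (_⁻¹ P δ) ρ) δ) → NormalClosure ρ γ
    one  : ∀ {γ} → _≈_ P γ (idA P) → NormalClosure ρ γ
    mul  : ∀ {α β γ} → NormalClosure ρ α → NormalClosure ρ β
         → _≈_ P γ (_·_ P α β) → NormalClosure ρ γ
    inv  : ∀ {α γ} → NormalClosure ρ α → _≈_ P γ (_⁻¹ P α) → NormalClosure ρ γ

-- Conjugating ρ by δ gives an automorphism that maps the flag Φδ to its (n-1)-neighbour,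
-- so in a regular maniplex every (n-1)-edge is realised by a conjugate of ρ; hence N⁺
-- satisfies the canonical condition, and every subgroup satisfying it contains N⁺.
-- Such a subgroup is automatically transitive on facets (walk along a path of flags,
-- absorbing each (n-1)-edge into the group), so the only real content of regularity on
-- facets is freeness, which passes from G down to the subgroup N⁺.
module Submission where

open import Defs
open import Data.Nat using (ℕ; suc)
open import Data.Fin using (inject₁)
open import Data.Fin.Relation.Unary.Top using (view; ‵fromℕ; ‵inj₁)
open import Data.Product using (_×_; Σ; _,_)
open import Relation.Binary.PropositionalEquality
  using (_≡_; refl; sym; trans; cong; subst; module ≡-Reasoning)
open import Relation.Binary.Construct.Closure.ReflexiveTransitive using (Star; ε; _◅_)

module _ {n : ℕ} (P : Premaniplex n) where
  open Premaniplex P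

  conjugate : Aut P → Aut P → Aut P
  conjugate ρ δ = _·_ P (_·_ P (_⁻¹ P δ) ρ) δ

  act-agrees-along : ∀ (γ δ : Aut P) {Ψ Ψ'} → Star (Step P) Ψ Ψ' →
                     act γ Ψ ≡ act δ Ψ → act γ Ψ' ≡ act δ Ψ'
  act-agrees-along γ δ ε eq = eq
  act-agrees-along γ δ {Ψ} ((i , refl) ◅ path) eq = act-agrees-along γ δ path (begin
    act γ (r i Ψ)  ≡⟨ comm γ i Ψ ⟩
    r i (act γ Ψ)  ≡⟨ cong (r i) eq ⟩
    r i (act δ Ψ)  ≡⟨ comm δ i Ψ ⟨
    act δ (r i Ψ)  ∎)
    where open ≡-Reasoning

  ≈-fromFlag : Connected P → ∀ (γ δ : Aut P) Ψ → act γ Ψ ≡ act δ Ψ → _≈_ P γ δ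
  ≈-fromFlag connected γ δ Ψ eq Ψ' = act-agrees-along γ δ (connected Ψ Ψ') eq

module _ {m : ℕ} (P : Premaniplex (suc m)) where
  open Premaniplex P

  ContainsTopSwitches : (Aut P → Set) → Set
  ContainsTopSwitches G = ∀ Ψ → Σ (Aut P) λ γ → G γ × (r (top P) Ψ ≡ act γ Ψ)

  NormalClosure-isSubgroup : ∀ ρ → IsSubgroup P (NormalClosure P ρ)
  NormalClosure-isSubgroup ρ = record
    { resp    = λ {γ} {δ} γ≈δ γ∈N → mul γ∈N (one {γ = idA P} λ _ → refl) λ Ψ → sym (γ≈δ Ψ)
    ; has-id  = one {γ = idA P} λ _ → refl
    ; has-mul = λ {γ} {δ} γ∈N δ∈N → mul {γ = _·_ P γ δ} γ∈N δ∈N λ _ → refl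
    ; has-inv = λ {γ} γ∈N → inv {γ = _⁻¹ P γ} γ∈N λ _ → refl
    }

  NormalClosure-minimal : ∀ ρ (G : Aut P → Set) → IsSubgroup P G →
                          (∀ δ → G (conjugate P ρ δ)) → ∀ {γ} → NormalClosure P ρ γ → G γ
  NormalClosure-minimal ρ G G-sub conj∈G = go
    where
    open IsSubgroup G-sub
    ∈-by : ∀ {γ δ} → _≈_ P γ δ → G δ → G γ
    ∈-by γ≈δ = resp λ Ψ → sym (γ≈δ Ψ)
    go : ∀ {γ} → NormalClosure P ρ γ → G γ
    go (conj δ γ≈)      = ∈-by γ≈ (conj∈G δ)
    go (one γ≈)         = ∈-by γ≈ has-id
    go (mul α∈N β∈N γ≈) = ∈-by γ≈ (has-mul (go α∈N) (go β∈N))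
    go (inv α∈N γ≈)     = ∈-by γ≈ (has-inv (go α∈N))

  moveToFacet : ∀ (G : Aut P → Set) → IsSubgroup P G → ContainsTopSwitches G →
                ∀ {Ψ Ψ'} → Star (Step P) Ψ Ψ' → Σ (Aut P) λ γ → G γ × SameFacet P (act γ Ψ) Ψ'
  moveToFacet G G-sub switches ε = idA P , IsSubgroup.has-id G-sub , ε
  moveToFacet G G-sub switches {Ψ} {Ψ'} ((i , step) ◅ path)
    with moveToFacet G G-sub switches path | view i
  ... | γ , γ∈G , sameFacet | ‵fromℕ with switches Ψ
  ...   | τ , τ∈G , Ψτ = _·_ P τ γ , IsSubgroup.has-mul G-sub τ∈G γ∈G ,
          subst (λ Ξ → SameFacet P (act γ Ξ) Ψ') (trans (sym step) Ψτ) sameFacet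
  moveToFacet G G-sub switches {Ψ} ((_ , step) ◅ path)
      | γ , γ∈G , sameFacet | ‵inj₁ {i = j} _ =
    γ , γ∈G , (j , trans (sym (comm γ (inject₁ j) Ψ)) (cong (act γ) step)) ◅ sameFacet

  transitiveOnFacets : Connected P → ∀ (G : Aut P → Set) → IsSubgroup P G → ContainsTopSwitches G →
                       ∀ Ψ Ψ' → Σ (Aut P) λ γ → G γ × SameFacet P (act γ Ψ) Ψ'
  transitiveOnFacets connected G G-sub switches Ψ Ψ' = moveToFacet G G-sub switches (connected Ψ Ψ')

  module _ (Φ : Flag) (ρ : Aut P) (Φρ : act ρ Φ ≡ r (top P) Φ) where

    conjugate-switchesTop : ∀ δ → act (conjugate P ρ δ) (act δ Φ) ≡ r (top P) (act δ Φ)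
    conjugate-switchesTop δ = begin
      act δ (act ρ (actInv δ (act δ Φ)))  ≡⟨ cong (λ Ξ → act δ (act ρ Ξ)) (inv-l δ Φ) ⟩
      act δ (act ρ Φ)                     ≡⟨ cong (act δ) Φρ ⟩
      act δ (r (top P) Φ)                 ≡⟨ comm δ (top P) Φ ⟩
      r (top P) (act δ Φ)                 ∎
      where open ≡-Reasoning

    NormalClosure-containsTopSwitches : IsRegular P → ContainsTopSwitches (NormalClosure P ρ)
    NormalClosure-containsTopSwitches regular Ψ with regular Φ Ψ
    ... | δ , refl = conjugate P ρ δ , conj δ (λ _ → refl) , sym (conjugate-switchesTop δ)

    conjugate-∈ : Connected P → ∀ (G : Aut P → Set) → IsSubgroup P G → ContainsTopSwitches G →
                  ∀ δ → G (conjugate P ρ δ)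
    conjugate-∈ connected G G-sub switches δ with switches (act δ Φ)
    ... | γ , γ∈G , Φδγ = IsSubgroup.resp G-sub
          (≈-fromFlag P connected γ (conjugate P ρ δ) (act δ Φ)
            (sym (trans (conjugate-switchesTop δ) Φδγ)))
          γ∈G

proposition3p10 :
    ∀ {m : ℕ} (M : Premaniplex (suc m)) → IsManiplex M → IsRegular M →
    (Φ : Premaniplex.Flag M) →
    (ρ : Aut M) → act ρ Φ ≡ Premaniplex.r M (top M) Φ →
    (IsCanonicalCayleyExtension M → ActsRegularlyOnFacets M (NormalClosure M ρ))
    × (ActsRegularlyOnFacets M (NormalClosure M ρ) → IsCanonicalCayleyExtension M)
proposition3p10 M (connected , _) regular Φ ρ Φρ = canonical⇒N-regular , N-regular⇒canonical
  where
  N-sub : IsSubgroup M (NormalClosure M ρ)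
  N-sub = NormalClosure-isSubgroup M ρ

  N-switches : ContainsTopSwitches M (NormalClosure M ρ)
  N-switches = NormalClosure-containsTopSwitches M Φ ρ Φρ regular

  canonical⇒N-regular : IsCanonicalCayleyExtension M → ActsRegularlyOnFacets M (NormalClosure M ρ)
  canonical⇒N-regular (G , G-sub , (_ , G-free) , G-switches) =
      transitiveOnFacets M connected (NormalClosure M ρ) N-sub N-switches
    , λ γ γ∈N → G-free γ (NormalClosure-minimal M ρ G G-sub
                            (conjugate-∈ M Φ ρ Φρ connected G G-sub G-switches) γ∈N)

  N-regular⇒canonical : ActsRegularlyOnFacets M (NormalClosure M ρ) → IsCanonicalCayleyExtension M
  N-regular⇒canonical N-regular = NormalClosure M ρ , N-sub , N-regular , N-switches
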